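{- For all integers $r \geq 3$, $t \geq r-2$ and $s \geq 0$, $f(r+s,t+s) \geq f(r,t)$.
   Context: All graphs are finite and simple. A graph is $K_r$-saturated if it contains no copy of $K_r$ but adding any new edge creates a copy of $K_r$. $f(r,t)$ is the maximum, over all $K_r$-saturated graphs $G$, of the number of vertices of degree at most $t$ adjacent to some other vertex of degree at most $t$. -}

module Defs where

open import Data.Nat using (ℕ; _≤_; _≤ᵇ_)
open import Data.Bool using (Bool; true; false; _∧_; _∨_; if_then_else_)
open import Data.Fin using (Fin; _≟_)
open import Data.List using (List; map; allFin)
open import Data.Nat.ListAction using (sum)
open import Data.Bool.ListAction using (any)
open import Data.Product using (Σ; ∃; _×_)
open import Relation.Nullary using (¬_; ⌊_⌋)
open import Relation.Binary.PropositionalEquality using (_≡_; _≢_)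

record Graph (n : ℕ) : Set where
  field
    adj    : Fin n → Fin n → Bool
    sym    : ∀ i j → adj i j ≡ adj j i
    irrefl : ∀ i → adj i i ≡ false
open Graph public

addEdge : ∀ {n} → (Fin n → Fin n → Bool) → Fin n → Fin n → (Fin n → Fin n → Bool)
addEdge a u v x y =
  a x y ∨ ((⌊ x ≟ u ⌋ ∧ ⌊ y ≟ v ⌋) ∨ (⌊ x ≟ v ⌋ ∧ ⌊ y ≟ u ⌋))

HasClique : ∀ {n} → ℕ → (Fin n → Fin n → Bool) → Set
HasClique {n} r a =
  Σ (Fin r → Fin n) λ f →
    (∀ i j → f i ≡ f j → i ≡ j) × (∀ i j → i ≢ j → a (f i) (f j) ≡ true)

Saturated : ∀ {n} → ℕ → Graph n → Set
Saturated r G =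
  ¬ HasClique r (adj G) ×
  (∀ u v → u ≢ v → adj G u v ≡ false → HasClique r (addEdge (adj G) u v))

degree : ∀ {n} → Graph n → Fin n → ℕ
degree {n} G i = sum (map (λ j → if adj G i j then 1 else 0) (allFin n))

low : ∀ {n} → ℕ → Graph n → Fin n → Bool
low t G i = degree G i ≤ᵇ t

good : ∀ {n} → ℕ → Graph n → Fin n → Bool
good {n} t G i = low t G i ∧ any (λ j → adj G i j ∧ low t G j) (allFin n)

countGood : ∀ {n} → ℕ → Graph n → ℕ
countGood {n} t G = sum (map (λ i → if good t G i then 1 else 0) (allFin n))

-- "f(r,t) ≥ k": some K_r-saturated graph has at least k such vertices.
-- (f(r,t) is the supremum of countGood over K_r-saturated graphs.)
fAtLeast : ℕ → ℕ → ℕ → Set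
fAtLeast r t k = ∃ λ n → Σ (Graph n) λ G → Saturated r G × k ≤ countGood t G

{-# OPTIONS --safe #-}
-- Idea: join a universal vertex to a K_r-saturated graph G. The cone is
-- K_(r+1)-saturated: a K_(r+1) in it would leave a K_r in G after deleting
-- the apex, and a K_r created in G by a new edge extends by the apex. Every
-- old vertex gains exactly one neighbour, so a vertex of degree ≤ t adjacent
-- to another such vertex becomes one of degree ≤ t + 1 with the same property.
-- Iterating s times gives the claim.
module Submission where

open import Defs
open import Data.Nat using (ℕ; _≤_; _+_; _∸_; zero; suc; _≤ᵇ_; z≤n)
open import Data.Nat.Properties using (+-suc; +-identityʳ; ≤-refl; ≤-trans; +-mono-≤; m≤n+m; module ≤-Reasoning)
open import Data.Bool using (Bool; true; false; _∧_; _∨_; if_then_else_)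
open import Data.Fin using (Fin; zero; suc; punchIn; punchOut; _≟_)
open import Data.Fin.Properties using (punchInᵢ≢i; punchIn-injective; punchIn-punchOut; suc-injective; any?)
open import Data.List using ([]; _∷_; map; allFin)
open import Data.List.Properties using (map-tabulate; map-cong)
open import Data.Nat.ListAction using (sum)
open import Data.Bool.ListAction using (any; or)
open import Data.Product using (∃; _×_; _,_; proj₁; proj₂)
open import Data.Empty using (⊥-elim)
open import Function using (_∘_; id)
open import Relation.Nullary using (yes; no; ⌊_⌋)
open import Relation.Binary.PropositionalEquality
  using (_≡_; _≢_; _≗_; refl; trans; cong; cong₂; module ≡-Reasoning)
  renaming (sym to ≡-sym)

map-allFin-suc : ∀ {A : Set} {n} (g : Fin (suc n) → A) →
  map g (allFin (suc n)) ≡ g zero ∷ map (g ∘ suc) (allFin n)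
map-allFin-suc g =
  cong (g zero ∷_) (trans (map-tabulate suc g) (≡-sym (map-tabulate id (g ∘ suc))))

sum-map-mono : ∀ {A : Set} {f g : A → ℕ} → (∀ x → f x ≤ g x) →
  ∀ xs → sum (map f xs) ≤ sum (map g xs)
sum-map-mono f≤g []       = z≤n
sum-map-mono f≤g (x ∷ xs) = +-mono-≤ (f≤g x) (sum-map-mono f≤g xs)

any-cong : ∀ {A : Set} {p q : A → Bool} → p ≗ q → ∀ xs → any p xs ≡ any q xs
any-cong p≗q xs = cong or (map-cong p≗q xs)

suc-≤ᵇ-suc : ∀ m n → (suc m ≤ᵇ suc n) ≡ (m ≤ᵇ n)
suc-≤ᵇ-suc zero    n = refl
suc-≤ᵇ-suc (suc m) n = refl

∧-true : ∀ {a b} → (a ∧ b) ≡ true → (a ≡ true) × (b ≡ true)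
∧-true {true} {true} _ = refl , refl

∨-trueʳ : ∀ a {b} → b ≡ true → (a ∨ b) ≡ true
∨-trueʳ true  _ = refl
∨-trueʳ false e = e

⌊suc≟suc⌋ : ∀ {n} (x y : Fin n) → ⌊ suc x ≟ suc y ⌋ ≡ ⌊ x ≟ y ⌋
⌊suc≟suc⌋ x y with x ≟ y
... | yes _ = refl
... | no _  = refl

-- By injectivity v is hit at most once; punching in at that index avoids it.
∃-punchIn-avoiding : ∀ {r m} (f : Fin (suc r) → Fin m) →
  (∀ i j → f i ≡ f j → i ≡ j) → ∀ v → ∃ λ i → ∀ j → f (punchIn i j) ≢ v
∃-punchIn-avoiding f f-inj v with any? (λ i → f i ≟ v)
... | yes (i , fi≡v) = i , λ j fj≡v →
  punchInᵢ≢i i j (f-inj _ _ (trans fj≡v (≡-sym fi≡v)))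
... | no ¬∃ = zero , λ j fj≡v → ¬∃ (punchIn zero j , fj≡v)

cone : ∀ {n} → Graph n → Graph (suc n)
cone G = record { adj = coneAdj ; sym = coneSym ; irrefl = coneIrrefl }
  where
  coneAdj : _ → _ → Bool
  coneAdj zero    zero    = false
  coneAdj zero    (suc j) = true
  coneAdj (suc i) zero    = true
  coneAdj (suc i) (suc j) = adj G i j
  coneSym : ∀ i j → coneAdj i j ≡ coneAdj j i
  coneSym zero    zero    = refl
  coneSym zero    (suc j) = refl
  coneSym (suc i) zero    = refl
  coneSym (suc i) (suc j) = Graph.sym G i j
  coneIrrefl : ∀ i → coneAdj i i ≡ false
  coneIrrefl zero    = refl
  coneIrrefl (suc i) = irrefl G i

cone-HasClique⇒HasClique : ∀ {n} r (G : Graph n) →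
  HasClique (suc r) (adj (cone G)) → HasClique r (adj G)
cone-HasClique⇒HasClique r G (f , f-inj , f-clique) = g , g-inj , g-clique
  where
  avoid = ∃-punchIn-avoiding f f-inj zero
  i₀ = proj₁ avoid
  apex≢ : ∀ j → zero ≢ f (punchIn i₀ j)
  apex≢ j = proj₂ avoid j ∘ ≡-sym
  g : Fin r → Fin _
  g j = punchOut (apex≢ j)
  suc-g : ∀ j → suc (g j) ≡ f (punchIn i₀ j)
  suc-g j = punchIn-punchOut (apex≢ j)
  g-inj : ∀ a b → g a ≡ g b → a ≡ b
  g-inj a b ga≡gb = punchIn-injective i₀ a b
    (f-inj _ _ (trans (≡-sym (suc-g a)) (trans (cong suc ga≡gb) (suc-g b))))
  g-clique : ∀ a b → a ≢ b → adj G (g a) (g b) ≡ true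
  g-clique a b a≢b = trans (cong₂ (adj (cone G)) (suc-g a) (suc-g b))
    (f-clique _ _ (a≢b ∘ punchIn-injective i₀ a b))

addEdge-HasClique-cone : ∀ {n} r (G : Graph n) u v →
  HasClique r (addEdge (adj G) u v) →
  HasClique (suc r) (addEdge (adj (cone G)) (suc u) (suc v))
addEdge-HasClique-cone {n} r G u v (h , h-inj , h-clique) = H , H-inj , H-clique
  where
  H : Fin (suc r) → Fin (suc n)
  H zero    = zero
  H (suc i) = suc (h i)
  H-inj : ∀ i j → H i ≡ H j → i ≡ j
  H-inj zero    zero    _ = refl
  H-inj (suc i) (suc j) e = cong suc (h-inj i j (suc-injective e))
  H-clique : ∀ i j → i ≢ j → addEdge (adj (cone G)) (suc u) (suc v) (H i) (H j) ≡ true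
  H-clique zero    zero    i≢j = ⊥-elim (i≢j refl)
  H-clique zero    (suc j) _   = refl
  H-clique (suc i) zero    _   = refl
  H-clique (suc i) (suc j) i≢j
    rewrite ⌊suc≟suc⌋ (h i) u | ⌊suc≟suc⌋ (h j) v | ⌊suc≟suc⌋ (h i) v | ⌊suc≟suc⌋ (h j) u
    = h-clique i j (i≢j ∘ cong suc)

cone-Saturated : ∀ {n} r (G : Graph n) → Saturated r G → Saturated (suc r) (cone G)
cone-Saturated r G (¬clique , saturating) = ¬clique ∘ cone-HasClique⇒HasClique r G , saturating′
  where
  saturating′ : ∀ u v → u ≢ v → adj (cone G) u v ≡ false →
    HasClique (suc r) (addEdge (adj (cone G)) u v)
  saturating′ zero    zero    u≢v _ = ⊥-elim (u≢v refl)
  saturating′ (suc u) (suc v) u≢v uv∉G =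
    addEdge-HasClique-cone r G u v (saturating u v (u≢v ∘ cong suc) uv∉G)

degree-cone : ∀ {n} (G : Graph n) i → degree (cone G) (suc i) ≡ suc (degree G i)
degree-cone G i = cong sum (map-allFin-suc (λ j → if adj (cone G) (suc i) j then 1 else 0))

low-cone : ∀ {n} t (G : Graph n) i → low (suc t) (cone G) (suc i) ≡ low t G i
low-cone t G i = trans (cong (_≤ᵇ suc t) (degree-cone G i)) (suc-≤ᵇ-suc (degree G i) t)

good-cone : ∀ {n} t (G : Graph n) i → good t G i ≡ true → good (suc t) (cone G) (suc i) ≡ true
good-cone {n} t G i good-i with ∧-true {low t G i} good-i
... | low-i , has-low-neighbour = cong₂ _∧_ (trans (low-cone t G i) low-i) (begin
  any (λ j → adj (cone G) (suc i) j ∧ low (suc t) (cone G) j) (allFin (suc n))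
    ≡⟨ cong or (map-allFin-suc (λ j → adj (cone G) (suc i) j ∧ low (suc t) (cone G) j)) ⟩
  low (suc t) (cone G) zero ∨ any (λ j → adj G i j ∧ low (suc t) (cone G) (suc j)) (allFin n)
    ≡⟨ ∨-trueʳ _ (trans (any-cong (cong (adj G i _ ∧_) ∘ low-cone t G) (allFin n)) has-low-neighbour) ⟩
  true ∎)
  where open ≡-Reasoning

countGood-cone : ∀ {n} t (G : Graph n) → countGood t G ≤ countGood (suc t) (cone G)
countGood-cone {n} t G = begin
  sum (map (indicator ∘ good t G) (allFin n))
    ≤⟨ sum-map-mono indicator-mono (allFin n) ⟩
  sum (map (indicator ∘ good (suc t) (cone G) ∘ suc) (allFin n))
    ≤⟨ m≤n+m _ _ ⟩
  indicator (good (suc t) (cone G) zero) + sum (map (indicator ∘ good (suc t) (cone G) ∘ suc) (allFin n))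
    ≡⟨ cong sum (map-allFin-suc (indicator ∘ good (suc t) (cone G))) ⟨
  countGood (suc t) (cone G) ∎
  where
  open ≤-Reasoning
  indicator : Bool → ℕ
  indicator b = if b then 1 else 0
  indicator-mono : ∀ i → indicator (good t G i) ≤ indicator (good (suc t) (cone G) (suc i))
  indicator-mono i with good t G i in good-i
  ... | false = z≤n
  ... | true rewrite good-cone t G i good-i = ≤-refl

fAtLeast-suc : ∀ r t k → fAtLeast r t k → fAtLeast (suc r) (suc t) k
fAtLeast-suc r t k (n , G , G-saturated , k≤count) =
  suc n , cone G , cone-Saturated r G G-saturated , ≤-trans k≤count (countGood-cone t G)

fAtLeast-+ : ∀ r t k s → fAtLeast r t k → fAtLeast (r + s) (t + s) k
fAtLeast-+ r t k zero
  rewrite +-identityʳ r | +-identityʳ t = id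
fAtLeast-+ r t k (suc s)
  rewrite +-suc r s | +-suc t s = fAtLeast-suc (r + s) (t + s) k ∘ fAtLeast-+ r t k s

lemma2 : (r t s : ℕ) → 3 ≤ r → r ∸ 2 ≤ t →
    (k : ℕ) → fAtLeast r t k → fAtLeast (r + s) (t + s) k
lemma2 r t s _ _ k = fAtLeast-+ r t k s
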